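{- Let $a \in \{\tfrac12, -\tfrac12\}$ and let $n \ge 2$ be an integer. Then $K_{a,n}(x) = x^n + (1-x)^n + a^n$ is irreducible over $\mathbb{Q}$. -}

module Defs where

open import Data.Nat using (ℕ; zero; suc; _≤_)
open import Data.List using (List; []; _∷_)
open import Data.Rational using (ℚ; 0ℚ; 1ℚ; _+_; _*_; -_)
open import Data.Product using (_×_; ∃-syntax)
open import Relation.Binary.PropositionalEquality using (_≡_; _≢_)
open import Relation.Nullary using (¬_)

-- Univariate polynomials over ℚ, as coefficient lists (constant term first).
-- Trailing zeros are allowed; equality of polynomials is coefficientwise (_≈ₚ_).
Poly : Set
Poly = List ℚ

coeff : Poly → ℕ → ℚ
coeff []       _       = 0ℚ
coeff (c ∷ p)  zero    = c
coeff (c ∷ p)  (suc i) = coeff p i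

infix 4 _≈ₚ_
_≈ₚ_ : Poly → Poly → Set
p ≈ₚ q = ∀ i → coeff p i ≡ coeff q i

infixl 6 _+ₚ_
infixl 7 _*ₚ_ _·ₚ_

_+ₚ_ : Poly → Poly → Poly
[]      +ₚ q       = q
(a ∷ p) +ₚ []      = a ∷ p
(a ∷ p) +ₚ (b ∷ q) = (a + b) ∷ (p +ₚ q)

_·ₚ_ : ℚ → Poly → Poly
c ·ₚ []      = []
c ·ₚ (a ∷ p) = (c * a) ∷ (c ·ₚ p)

_*ₚ_ : Poly → Poly → Poly
[]      *ₚ q = []
(a ∷ p) *ₚ q = (a ·ₚ q) +ₚ (0ℚ ∷ (p *ₚ q))

const : ℚ → Poly
const c = c ∷ []

X : Poly
X = 0ℚ ∷ 1ℚ ∷ []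

_^ₚ_ : Poly → ℕ → Poly
p ^ₚ zero  = const 1ℚ
p ^ₚ suc n = p *ₚ (p ^ₚ n)

NonConstant : Poly → Set
NonConstant p = ∃[ i ] (1 ≤ i × coeff p i ≢ 0ℚ)

-- Irreducible over ℚ: nonconstant, and not a product of two nonconstant
-- polynomials (units of ℚ[x] are the nonzero constants).
Irreducible : Poly → Set
Irreducible p = NonConstant p × (∀ f g → p ≈ₚ f *ₚ g → ¬ (NonConstant f × NonConstant g))

_^ℚ_ : ℚ → ℕ → ℚ
c ^ℚ zero  = 1ℚ
c ^ℚ suc n = c * (c ^ℚ n)

K : ℚ → ℕ → Poly
K a n = (X ^ₚ n) +ₚ ((const 1ℚ +ₚ (- 1ℚ) ·ₚ X) ^ₚ n) +ₚ const (a ^ℚ n)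

-- Let ν be the 2-adic valuation and n ≥ 2. The constant term 1 + a^n of K a n has ν = −n, the
-- coefficients in degrees 1 … n − 1 come from (1 − x)^n and are integers (ν ≥ 0), and the top
-- coefficient is 2 (ν = 1) in degree n when n is even, resp. n (ν = 0) in degree n − 1 when n is
-- odd. So the 2-adic Newton polygon of K a n is one segment, of slope (n + 1)/n resp. n/(n − 1),
-- with no lattice points besides its ends. By Dumas, the Newton polygon of a product is assembled
-- from those of the factors, so a factorisation would split this segment at a lattice point.

module Submission where

open import Defs
open import Data.Nat as ℕ using (ℕ; zero; suc; z≤n; s≤s; _≥_)
import Data.Nat.Properties as ℕP
open import Data.Nat.Induction using (<-rec)
open import Data.Nat.Divisibility using (_∣_; divides)
open import Data.Nat.Coprimality as Coprime using (Coprime; coprime-divisor; coprime-+; 1-coprimeTo)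
open import Data.Integer as ℤ using (ℤ; +_; -[1+_]; 0ℤ; 1ℤ; ∣_∣)
import Data.Integer.Properties as ℤP
open import Data.Integer.Tactic.RingSolver using (solve; solve-∀)
open import Data.List using ([]; _∷_; length)
open import Data.Rational using (ℚ; 0ℚ; 1ℚ; _+_; _*_; -_; toℚᵘ; ½; -½)
import Data.Rational.Properties as ℚP
open import Data.Rational.Unnormalised as ℚᵘ using (ℚᵘ; mkℚᵘ; *≡*)
import Data.Rational.Unnormalised.Properties as ℚᵘP
open import Data.Product using (∃-syntax; ∃₂; _×_; _,_; proj₁; proj₂; map₂)
open import Data.Sum as Sum using (_⊎_; inj₁; inj₂; [_,_]′)
open import Data.Empty using (⊥; ⊥-elim)
open import Function using (_∘_; flip)
open import Relation.Nullary using (¬_; yes; no; ¬?)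
open import Relation.Unary using (Decidable)
open import Relation.Binary.Definitions using (tri<; tri≈; tri>)
open import Relation.Binary.Structures using (IsStrictTotalOrder)
import Relation.Binary.Construct.Flip.EqAndOrd as Flip
open import Relation.Binary.PropositionalEquality

-- 2-adic valuation of integers

parity : ∀ n → ∃[ t ] (n ≡ t ℕ.+ t ⊎ n ≡ suc (t ℕ.+ t))
parity zero = 0 , inj₁ refl
parity (suc n) with parity n
... | t , inj₁ refl = t , inj₂ refl
... | t , inj₂ refl = suc t , inj₁ (cong suc (sym (ℕP.+-suc t t)))

Odd : ℤ → Set
Odd u = ∃[ t ] u ≡ 1ℤ ℤ.+ (t ℤ.+ t)

double≢1 : ∀ x → x ℤ.+ x ≢ 1ℤ
double≢1 (+ zero) ()
double≢1 (+ suc n) e = ℕP.m+1+n≢0 n (ℕP.suc-injective (ℤP.+-injective e))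
double≢1 -[1+ n ] ()

odd≢double : ∀ {u} → Odd u → ∀ r → u ≢ r ℤ.+ r
odd≢double (t , refl) r e = double≢1 (r ℤ.- t) (begin
  (r ℤ.- t) ℤ.+ (r ℤ.- t)          ≡⟨ solve (r ∷ t ∷ []) ⟩
  (r ℤ.+ r) ℤ.- (t ℤ.+ t)          ≡⟨ cong (ℤ._- (t ℤ.+ t)) (sym e) ⟩
  1ℤ ℤ.+ (t ℤ.+ t) ℤ.- (t ℤ.+ t)   ≡⟨ solve (t ∷ []) ⟩
  1ℤ                               ∎)
  where open ≡-Reasoning

odd≢0 : ∀ {u} → Odd u → u ≢ 0ℤ
odd≢0 odd = odd≢double odd 0ℤ

odd-* : ∀ {u w} → Odd u → Odd w → Odd (u ℤ.* w)
odd-* (t , refl) (r , refl) = t ℤ.+ r ℤ.+ (t ℤ.+ t) ℤ.* r , solve (t ∷ r ∷ [])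

odd-+-double : ∀ {u} → Odd u → ∀ r → Odd (u ℤ.+ (r ℤ.+ r))
odd-+-double (t , refl) r = t ℤ.+ r , solve (t ∷ r ∷ [])

odd-neg : ∀ {u} → Odd u → Odd (ℤ.- u)
odd-neg (t , refl) = ℤ.- t ℤ.- 1ℤ , solve (t ∷ [])

*-≢0 : ∀ {a b} → a ≢ 0ℤ → b ≢ 0ℤ → a ℤ.* b ≢ 0ℤ
*-≢0 {a} a≢0 b≢0 ab≡0 with ℤP.i*j≡0⇒i≡0∨j≡0 a ab≡0
... | inj₁ a≡0 = a≢0 a≡0
... | inj₂ b≡0 = b≢0 b≡0

2^k≢0 : ∀ k → (+ 2) ℤ.^ k ≢ 0ℤ
2^k≢0 k e with ℤP.i^n≡0⇒i≡0 (+ 2) k e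
... | ()

2^suc-double : ∀ k u → (+ 2) ℤ.^ suc k ℤ.* u ≡ ((+ 2) ℤ.^ k ℤ.* u) ℤ.+ ((+ 2) ℤ.^ k ℤ.* u)
2^suc-double k u = lemma ((+ 2) ℤ.^ k) u
  where
  lemma : ∀ p u → (+ 2 ℤ.* p) ℤ.* u ≡ p ℤ.* u ℤ.+ p ℤ.* u
  lemma = solve-∀

infix 4 2^_∥_
record 2^_∥_ (k : ℕ) (a : ℤ) : Set where
  constructor factor
  field
    oddPart : ℤ
    odd     : Odd oddPart
    split   : a ≡ (+ 2) ℤ.^ k ℤ.* oddPart

decompose⁺ : ∀ n → n ≢ 0 → ∃[ k ] 2^ k ∥ + n
decompose⁺ = <-rec _ step
  where
  step : ∀ n → (∀ {m} → m ℕ.< n → m ≢ 0 → ∃[ k ] 2^ k ∥ + m) → n ≢ 0 → ∃[ k ] 2^ k ∥ + n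
  step n rec n≢0 with parity n
  ... | t , inj₂ refl = 0 , factor (+ suc (t ℕ.+ t)) (+ t , refl) (sym (ℤP.*-identityˡ _))
  ... | zero , inj₁ refl = ⊥-elim (n≢0 refl)
  ... | t@(suc _) , inj₁ refl with rec (ℕP.m<m+n t (s≤s z≤n)) (λ ())
  ...   | k , factor u odd e = suc k , factor u odd (trans (cong₂ ℤ._+_ e e) (sym (2^suc-double k u)))

2^∥-neg : ∀ {k a} → 2^ k ∥ a → 2^ k ∥ ℤ.- a
2^∥-neg {k} (factor u odd refl) = factor (ℤ.- u) (odd-neg odd) (ℤP.neg-distribʳ-* ((+ 2) ℤ.^ k) u)

v₂ : ℤ → ℕ
v₂ (+ zero)  = 0  -- junk value
v₂ (+ suc n) = proj₁ (decompose⁺ (suc n) (λ ()))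
v₂ -[1+ n ]  = proj₁ (decompose⁺ (suc n) (λ ()))

v₂-spec : ∀ {a} → a ≢ 0ℤ → 2^ v₂ a ∥ a
v₂-spec {+ zero} a≢0 = ⊥-elim (a≢0 refl)
v₂-spec {+ suc n} _ = proj₂ (decompose⁺ (suc n) (λ ()))
v₂-spec { -[1+ n ]} _ = 2^∥-neg {v₂ (+ suc n)} {+ suc n} (proj₂ (decompose⁺ (suc n) (λ ())))

2^∥-injective : ∀ k l {a} → 2^ k ∥ a → 2^ l ∥ a → k ≡ l
2^∥-injective zero    zero    _ _ = refl
2^∥-injective zero    (suc l) (factor u odd refl) (factor w _ e) =
  ⊥-elim (odd≢double odd ((+ 2) ℤ.^ l ℤ.* w) (trans (sym (ℤP.*-identityˡ u)) (trans e (2^suc-double l w))))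
2^∥-injective (suc k) zero    (factor u _ e) (factor w odd refl) =
  ⊥-elim (odd≢double odd ((+ 2) ℤ.^ k ℤ.* u) (trans (sym (ℤP.*-identityˡ w)) (trans e (2^suc-double k u))))
2^∥-injective (suc k) (suc l) (factor u odd refl) (factor w odd′ e) =
  cong suc (2^∥-injective k l (factor u odd refl) (factor w odd′ halve))
  where
  halve : (+ 2) ℤ.^ k ℤ.* u ≡ (+ 2) ℤ.^ l ℤ.* w
  halve = ℤP.*-cancelˡ-≡ (+ 2) ((+ 2) ℤ.^ k ℤ.* u) ((+ 2) ℤ.^ l ℤ.* w)
            (trans (sym (ℤP.*-assoc (+ 2) ((+ 2) ℤ.^ k) u)) (trans e (ℤP.*-assoc (+ 2) ((+ 2) ℤ.^ l) w)))

v₂-unique : ∀ {a k} → 2^ k ∥ a → v₂ a ≡ k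
v₂-unique {a} {k} dec@(factor u odd refl) =
  2^∥-injective (v₂ a) k (v₂-spec (*-≢0 (2^k≢0 k) (odd≢0 odd))) dec

2^k∥2^k : ∀ k → 2^ k ∥ (+ 2) ℤ.^ k
2^k∥2^k k = factor 1ℤ (0ℤ , refl) (sym (ℤP.*-identityʳ _))

2^∥-* : ∀ {k l a b} → 2^ k ∥ a → 2^ l ∥ b → 2^ k ℕ.+ l ∥ a ℤ.* b
2^∥-* {k} {l} (factor u odd-u refl) (factor w odd-w refl) = factor (u ℤ.* w) (odd-* odd-u odd-w)
  (trans (regroup ((+ 2) ℤ.^ k) ((+ 2) ℤ.^ l) u w) (cong (ℤ._* (u ℤ.* w)) (sym (ℤP.^-distribˡ-+-* (+ 2) k l))))
  where
  regroup : ∀ p q u w → (p ℤ.* u) ℤ.* (q ℤ.* w) ≡ (p ℤ.* q) ℤ.* (u ℤ.* w)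
  regroup = solve-∀

v₂-* : ∀ {a b} → a ≢ 0ℤ → b ≢ 0ℤ → v₂ (a ℤ.* b) ≡ v₂ a ℕ.+ v₂ b
v₂-* a≢0 b≢0 = v₂-unique (2^∥-* (v₂-spec a≢0) (v₂-spec b≢0))

2^∥-+ : ∀ {k m a b} → 2^ k ∥ a → 2^ k ℕ.+ m ∥ b →
            ∃₂ λ u w → Odd u × a ℤ.+ b ≡ (+ 2) ℤ.^ k ℤ.* (u ℤ.+ (+ 2) ℤ.^ m ℤ.* w)
2^∥-+ {k} {m} (factor u odd-u refl) (factor w _ refl) = u , w , odd-u ,
  trans (cong (λ p → (+ 2) ℤ.^ k ℤ.* u ℤ.+ p ℤ.* w) (ℤP.^-distribˡ-+-* (+ 2) k m))
        (pull ((+ 2) ℤ.^ k) ((+ 2) ℤ.^ m) u w)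
  where
  pull : ∀ p q u w → p ℤ.* u ℤ.+ (p ℤ.* q) ℤ.* w ≡ p ℤ.* (u ℤ.+ q ℤ.* w)
  pull = solve-∀

v₂-+-≥ : ∀ {a b} → a ≢ 0ℤ → b ≢ 0ℤ → a ℤ.+ b ≢ 0ℤ → v₂ a ℕ.≤ v₂ b → v₂ a ℕ.≤ v₂ (a ℤ.+ b)
v₂-+-≥ {a} {b} a≢0 b≢0 a+b≢0 va≤vb
  with 2^∥-+ (v₂-spec a≢0) (subst (λ l → 2^ l ∥ b) (sym (ℕP.m+[n∸m]≡n va≤vb)) (v₂-spec b≢0))
... | u , w , _ , e = subst (v₂ a ℕ.≤_) (sym (v₂-unique a+b-split)) (ℕP.m≤m+n (v₂ a) (v₂ c))
  where
  c = u ℤ.+ (+ 2) ℤ.^ (v₂ b ℕ.∸ v₂ a) ℤ.* w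
  c≢0 : c ≢ 0ℤ
  c≢0 c≡0 = a+b≢0 (trans e (trans (cong ((+ 2) ℤ.^ v₂ a ℤ.*_) c≡0) (ℤP.*-zeroʳ ((+ 2) ℤ.^ v₂ a))))
  a+b-split : 2^ v₂ a ℕ.+ v₂ c ∥ a ℤ.+ b
  a+b-split = subst (2^ v₂ a ℕ.+ v₂ c ∥_) (sym e) (2^∥-* (2^k∥2^k (v₂ a)) (v₂-spec c≢0))

v₂-+-< : ∀ {a b} → a ≢ 0ℤ → b ≢ 0ℤ → v₂ a ℕ.< v₂ b → a ℤ.+ b ≢ 0ℤ × v₂ (a ℤ.+ b) ≡ v₂ a
v₂-+-< {a} {b} a≢0 b≢0 va<vb
  with 2^∥-+ (v₂-spec a≢0) (subst (λ l → 2^ l ∥ b) (sym (ℕP.m+[n∸m]≡n (ℕP.<⇒≤ va<vb))) (v₂-spec b≢0))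
... | u , w , odd-u , e = (λ a+b≡0 → *-≢0 (2^k≢0 (v₂ a)) (odd≢0 odd-c) (trans (sym e) a+b≡0)) ,
                          v₂-unique (factor c odd-c e)
  where
  m = v₂ b ℕ.∸ v₂ a
  c = u ℤ.+ (+ 2) ℤ.^ m ℤ.* w
  odd-c : Odd c
  odd-c with m | ℕP.m<n⇒0<n∸m va<vb
  ... | suc m′ | _ = subst Odd (cong (ℤ._+_ u) (sym (2^suc-double m′ w))) (odd-+-double odd-u ((+ 2) ℤ.^ m′ ℤ.* w))

-- 2-adic valuation of rationals

+-cancelʳ-< : ∀ c {i j} → i ℤ.+ c ℤ.< j ℤ.+ c → i ℤ.< j
+-cancelʳ-< c {i} {j} lt with ℤP.<-cmp i j
... | tri< i<j _ _  = i<j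
... | tri≈ _ refl _ = ⊥-elim (ℤP.<-irrefl refl lt)
... | tri> _ _ j<i  = ⊥-elim (ℤP.<-asym lt (ℤP.+-monoˡ-< c j<i))

diff-cong : ∀ a b c d → a ℕ.+ d ≡ c ℕ.+ b → + a ℤ.- + b ≡ + c ℤ.- + d
diff-cong a b c d e =
  trans (shift (+ a) (+ b) (+ d)) (trans (cong (λ n → + n ℤ.- (+ b ℤ.+ + d)) e) (sym (shift′ (+ c) (+ d) (+ b))))
  where
  shift : ∀ i j k → i ℤ.- j ≡ (i ℤ.+ k) ℤ.- (j ℤ.+ k)
  shift = solve-∀
  shift′ : ∀ i j k → i ℤ.- j ≡ (i ℤ.+ k) ℤ.- (k ℤ.+ j)
  shift′ = solve-∀

-- Computed on unnormalised fractions, where _+_ and _*_ have closed formulas.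
νᵘ : ℚᵘ → ℤ
νᵘ p = + v₂ (ℚᵘ.↥ p) ℤ.- + v₂ (ℚᵘ.↧ p)

↧≢0 : ∀ p → ℚᵘ.↧ p ≢ 0ℤ
↧≢0 (mkℚᵘ _ _) ()

νᵘ-rescale : ∀ {p r} → ℚᵘ.↥ p ≢ 0ℤ → r ≢ 0ℤ →
             νᵘ p ≡ + v₂ (ℚᵘ.↥ p ℤ.* r) ℤ.- + v₂ (ℚᵘ.↧ p ℤ.* r)
νᵘ-rescale {p} {r} ↥p≢0 r≢0 = diff-cong _ _ (v₂ (ℚᵘ.↥ p ℤ.* r)) (v₂ (ℚᵘ.↧ p ℤ.* r)) (begin
  v₂ (ℚᵘ.↥ p) ℕ.+ v₂ (ℚᵘ.↧ p ℤ.* r)          ≡⟨ cong (v₂ (ℚᵘ.↥ p) ℕ.+_) (v₂-* (↧≢0 p) r≢0) ⟩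
  v₂ (ℚᵘ.↥ p) ℕ.+ (v₂ (ℚᵘ.↧ p) ℕ.+ v₂ r)     ≡⟨ swap (v₂ (ℚᵘ.↥ p)) (v₂ (ℚᵘ.↧ p)) (v₂ r) ⟩
  v₂ (ℚᵘ.↥ p) ℕ.+ v₂ r ℕ.+ v₂ (ℚᵘ.↧ p)       ≡⟨ cong (ℕ._+ v₂ (ℚᵘ.↧ p)) (sym (v₂-* ↥p≢0 r≢0)) ⟩
  v₂ (ℚᵘ.↥ p ℤ.* r) ℕ.+ v₂ (ℚᵘ.↧ p)         ∎)
  where
  open ≡-Reasoning
  swap : ∀ a b c → a ℕ.+ (b ℕ.+ c) ≡ a ℕ.+ c ℕ.+ b
  swap a b c = trans (cong (a ℕ.+_) (ℕP.+-comm b c)) (sym (ℕP.+-assoc a c b))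

≃-↥≢0 : ∀ {p q} → p ℚᵘ.≃ q → ℚᵘ.↥ p ≢ 0ℤ → ℚᵘ.↥ q ≢ 0ℤ
≃-↥≢0 {p} {q} (*≡* e) ↥p≢0 ↥q≡0 =
  *-≢0 ↥p≢0 (↧≢0 q) (trans e (trans (cong (ℤ._* ℚᵘ.↧ p) ↥q≡0) (ℤP.*-zeroˡ (ℚᵘ.↧ p))))

νᵘ-cong : ∀ {p q} → p ℚᵘ.≃ q → ℚᵘ.↥ p ≢ 0ℤ → νᵘ p ≡ νᵘ q
νᵘ-cong {p} {q} p≃q@(*≡* e) ↥p≢0 = diff-cong _ _ (v₂ (ℚᵘ.↥ q)) (v₂ (ℚᵘ.↧ q)) (begin
  v₂ (ℚᵘ.↥ p) ℕ.+ v₂ (ℚᵘ.↧ q)   ≡⟨ sym (v₂-* ↥p≢0 (↧≢0 q)) ⟩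
  v₂ (ℚᵘ.↥ p ℤ.* ℚᵘ.↧ q)        ≡⟨ cong v₂ e ⟩
  v₂ (ℚᵘ.↥ q ℤ.* ℚᵘ.↧ p)        ≡⟨ v₂-* (≃-↥≢0 p≃q ↥p≢0) (↧≢0 p) ⟩
  v₂ (ℚᵘ.↥ q) ℕ.+ v₂ (ℚᵘ.↧ p)   ∎)
  where open ≡-Reasoning

↥-* : ∀ p q → ℚᵘ.↥ (p ℚᵘ.* q) ≡ ℚᵘ.↥ p ℤ.* ℚᵘ.↥ q
↥-* (mkℚᵘ _ _) (mkℚᵘ _ _) = refl

↧-* : ∀ p q → ℚᵘ.↧ (p ℚᵘ.* q) ≡ ℚᵘ.↧ p ℤ.* ℚᵘ.↧ q
↧-* (mkℚᵘ _ b) (mkℚᵘ _ d) = ℤP.pos-* (suc b) (suc d)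

↥-+ : ∀ p q → ℚᵘ.↥ (p ℚᵘ.+ q) ≡ ℚᵘ.↥ p ℤ.* ℚᵘ.↧ q ℤ.+ ℚᵘ.↥ q ℤ.* ℚᵘ.↧ p
↥-+ (mkℚᵘ _ _) (mkℚᵘ _ _) = refl

↧-+ : ∀ p q → ℚᵘ.↧ (p ℚᵘ.+ q) ≡ ℚᵘ.↧ p ℤ.* ℚᵘ.↧ q
↧-+ (mkℚᵘ _ b) (mkℚᵘ _ d) = ℤP.pos-* (suc b) (suc d)

νᵘ-* : ∀ {p q} → ℚᵘ.↥ p ≢ 0ℤ → ℚᵘ.↥ q ≢ 0ℤ → νᵘ (p ℚᵘ.* q) ≡ νᵘ p ℤ.+ νᵘ q
νᵘ-* {p} {q} ↥p≢0 ↥q≢0 = begin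
  + v₂ (ℚᵘ.↥ (p ℚᵘ.* q)) ℤ.- + v₂ (ℚᵘ.↧ (p ℚᵘ.* q))
    ≡⟨ cong₂ (λ m n → + v₂ m ℤ.- + v₂ n) (↥-* p q) (↧-* p q) ⟩
  + v₂ (ℚᵘ.↥ p ℤ.* ℚᵘ.↥ q) ℤ.- + v₂ (ℚᵘ.↧ p ℤ.* ℚᵘ.↧ q)
    ≡⟨ cong₂ (λ m n → + m ℤ.- + n) (v₂-* ↥p≢0 ↥q≢0) (v₂-* (↧≢0 p) (↧≢0 q)) ⟩
  (+ v₂ (ℚᵘ.↥ p) ℤ.+ + v₂ (ℚᵘ.↥ q)) ℤ.- (+ v₂ (ℚᵘ.↧ p) ℤ.+ + v₂ (ℚᵘ.↧ q))
    ≡⟨ regroup (+ v₂ (ℚᵘ.↥ p)) (+ v₂ (ℚᵘ.↥ q)) (+ v₂ (ℚᵘ.↧ p)) (+ v₂ (ℚᵘ.↧ q)) ⟩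
  νᵘ p ℤ.+ νᵘ q ∎
  where
  open ≡-Reasoning
  regroup : ∀ a c b d → (a ℤ.+ c) ℤ.- (b ℤ.+ d) ≡ (a ℤ.- b) ℤ.+ (c ℤ.- d)
  regroup = solve-∀

module _ {p q} (↥p≢0 : ℚᵘ.↥ p ≢ 0ℤ) (↥q≢0 : ℚᵘ.↥ q ≢ 0ℤ) where
  private
    A = ℚᵘ.↥ p ℤ.* ℚᵘ.↧ q
    B = ℚᵘ.↥ q ℤ.* ℚᵘ.↧ p
    D = + v₂ (ℚᵘ.↧ p ℤ.* ℚᵘ.↧ q)

    A≢0 : A ≢ 0ℤ
    A≢0 = *-≢0 ↥p≢0 (↧≢0 q)

    B≢0 : B ≢ 0ℤ
    B≢0 = *-≢0 ↥q≢0 (↧≢0 p)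

    νᵘp : νᵘ p ≡ + v₂ A ℤ.- D
    νᵘp = νᵘ-rescale {p} ↥p≢0 (↧≢0 q)

    νᵘq : νᵘ q ≡ + v₂ B ℤ.- D
    νᵘq = trans (νᵘ-rescale {q} ↥q≢0 (↧≢0 p))
                (cong (λ r → + v₂ B ℤ.- + v₂ r) (ℤP.*-comm (ℚᵘ.↧ q) (ℚᵘ.↧ p)))

    νᵘp+q : νᵘ (p ℚᵘ.+ q) ≡ + v₂ (A ℤ.+ B) ℤ.- D
    νᵘp+q = cong₂ (λ m n → + v₂ m ℤ.- + v₂ n) (↥-+ p q) (↧-+ p q)

    shift-≤ : ∀ {m n} → m ℕ.≤ n → + m ℤ.- D ℤ.≤ + n ℤ.- D
    shift-≤ m≤n = ℤP.+-monoˡ-≤ (ℤ.- D) (ℤ.+≤+ m≤n)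

  νᵘ-+-≥ : ℚᵘ.↥ (p ℚᵘ.+ q) ≢ 0ℤ → νᵘ p ℤ.≤ νᵘ (p ℚᵘ.+ q) ⊎ νᵘ q ℤ.≤ νᵘ (p ℚᵘ.+ q)
  νᵘ-+-≥ ↥p+q≢0 with ℕP.≤-total (v₂ A) (v₂ B)
  ... | inj₁ vA≤vB = inj₁ (subst₂ ℤ._≤_ (sym νᵘp) (sym νᵘp+q) (shift-≤ (v₂-+-≥ A≢0 B≢0 A+B≢0 vA≤vB)))
    where A+B≢0 = λ e → ↥p+q≢0 (trans (↥-+ p q) e)
  ... | inj₂ vB≤vA = inj₂ (subst₂ ℤ._≤_ (sym νᵘq) (sym νᵘp+q)
                            (subst (λ s → + v₂ B ℤ.- D ℤ.≤ + v₂ s ℤ.- D) (ℤP.+-comm B A)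
                                   (shift-≤ (v₂-+-≥ B≢0 A≢0 B+A≢0 vB≤vA))))
    where B+A≢0 = λ e → ↥p+q≢0 (trans (↥-+ p q) (trans (ℤP.+-comm A B) e))

  νᵘ-+-< : νᵘ p ℤ.< νᵘ q → ℚᵘ.↥ (p ℚᵘ.+ q) ≢ 0ℤ × νᵘ (p ℚᵘ.+ q) ≡ νᵘ p
  νᵘ-+-< νp<νq = (λ e → proj₁ sum (trans (sym (↥-+ p q)) e)) ,
                  trans νᵘp+q (trans (cong (λ n → + n ℤ.- D) (proj₂ sum)) (sym νᵘp))
    where
    vA<vB : v₂ A ℕ.< v₂ B
    vA<vB = ℤP.drop‿+<+ (+-cancelʳ-< (ℤ.- D) (subst₂ ℤ._<_ νᵘp νᵘq νp<νq))
    sum = v₂-+-< A≢0 B≢0 vA<vB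

≢0⇒↥≢0 : ∀ {x} → x ≢ 0ℚ → ℚᵘ.↥ (toℚᵘ x) ≢ 0ℤ
≢0⇒↥≢0 {x@record{}} x≢0 ↥≡0 = x≢0 (ℚP.↥p≡0⇒p≡0 x ↥≡0)

↥≢0⇒≢0 : ∀ {x} → ℚᵘ.↥ (toℚᵘ x) ≢ 0ℤ → x ≢ 0ℚ
↥≢0⇒≢0 {x@record{}} ↥≢0 x≡0 = ↥≢0 (ℚP.p≡0⇒↥p≡0 x x≡0)

record Ultrametric (w : ℚ → ℤ) : Set where
  field
    +-≥ : ∀ {x y} → x ≢ 0ℚ → y ≢ 0ℚ → x + y ≢ 0ℚ → w x ℤ.≤ w (x + y) ⊎ w y ℤ.≤ w (x + y)
    +-< : ∀ {x y} → x ≢ 0ℚ → y ≢ 0ℚ → w x ℤ.< w y → x + y ≢ 0ℚ × w (x + y) ≡ w x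

-- Opaque: unfolding ν would make Agda normalise the gcd computations inside ℚ arithmetic.
opaque
  ν : ℚ → ℤ
  ν x = νᵘ (toℚᵘ x)

  ν-* : ∀ {x y} → x ≢ 0ℚ → y ≢ 0ℚ → x * y ≢ 0ℚ × ν (x * y) ≡ ν x ℤ.+ ν y
  ν-* {x} {y} x≢0 y≢0 =
    ↥≢0⇒≢0 ↥xy≢0 , trans (νᵘ-cong homo ↥xy≢0) (νᵘ-* {toℚᵘ x} {toℚᵘ y} (≢0⇒↥≢0 x≢0) (≢0⇒↥≢0 y≢0))
    where
    homo : toℚᵘ (x * y) ℚᵘ.≃ toℚᵘ x ℚᵘ.* toℚᵘ y
    homo = ℚP.toℚᵘ-homo-* x y
    ↥xy≢0 : ℚᵘ.↥ (toℚᵘ (x * y)) ≢ 0ℤ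
    ↥xy≢0 = ≃-↥≢0 (ℚᵘP.≃-sym homo)
              (subst (_≢ 0ℤ) (sym (↥-* (toℚᵘ x) (toℚᵘ y))) (*-≢0 (≢0⇒↥≢0 x≢0) (≢0⇒↥≢0 y≢0)))

  ν-ultrametric : Ultrametric ν
  ν-ultrametric = record { +-≥ = ≥ ; +-< = < }
    where
    ≥ : ∀ {x y} → x ≢ 0ℚ → y ≢ 0ℚ → x + y ≢ 0ℚ → ν x ℤ.≤ ν (x + y) ⊎ ν y ℤ.≤ ν (x + y)
    ≥ {x} {y} x≢0 y≢0 x+y≢0 = subst (λ v → ν x ℤ.≤ v ⊎ ν y ℤ.≤ v) (sym (νᵘ-cong homo ↥x+y≢0))
        (νᵘ-+-≥ {toℚᵘ x} {toℚᵘ y} (≢0⇒↥≢0 x≢0) (≢0⇒↥≢0 y≢0) (≃-↥≢0 homo ↥x+y≢0))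
      where
      homo : toℚᵘ (x + y) ℚᵘ.≃ toℚᵘ x ℚᵘ.+ toℚᵘ y
      homo = ℚP.toℚᵘ-homo-+ x y
      ↥x+y≢0 : ℚᵘ.↥ (toℚᵘ (x + y)) ≢ 0ℤ
      ↥x+y≢0 = ≢0⇒↥≢0 x+y≢0
    < : ∀ {x y} → x ≢ 0ℚ → y ≢ 0ℚ → ν x ℤ.< ν y → x + y ≢ 0ℚ × ν (x + y) ≡ ν x
    < {x} {y} x≢0 y≢0 νx<νy = x+y≢0 , trans (νᵘ-cong homo (≢0⇒↥≢0 x+y≢0)) (proj₂ sum)
      where
      homo : toℚᵘ (x + y) ℚᵘ.≃ toℚᵘ x ℚᵘ.+ toℚᵘ y
      homo = ℚP.toℚᵘ-homo-+ x y
      sum : ℚᵘ.↥ (toℚᵘ x ℚᵘ.+ toℚᵘ y) ≢ 0ℤ × νᵘ (toℚᵘ x ℚᵘ.+ toℚᵘ y) ≡ νᵘ (toℚᵘ x)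
      sum = νᵘ-+-< {toℚᵘ x} {toℚᵘ y} (≢0⇒↥≢0 x≢0) (≢0⇒↥≢0 y≢0) νx<νy
      x+y≢0 : x + y ≢ 0ℚ
      x+y≢0 = ↥≢0⇒≢0 (≃-↥≢0 (ℚᵘP.≃-sym homo) (proj₁ sum))

  ν-1 : ν 1ℚ ≡ 0ℤ
  ν-1 = refl

  ν-[-1] : ν (- 1ℚ) ≡ 0ℤ
  ν-[-1] = refl

  ν-2 : ν (1ℚ + 1ℚ) ≡ 1ℤ
  ν-2 = refl

  ν-½ : ν ½ ≡ ℤ.- 1ℤ
  ν-½ = refl

  ν-[-½] : ν -½ ≡ ℤ.- 1ℤ
  ν-[-½] = refl

infix 4 _≤[_]_ _<[_]_ _≡[_]_

-- Bounds on w x that hold vacuously at x = 0, where w carries no information.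
_≤[_]_ : ℤ → (ℚ → ℤ) → ℚ → Set
T ≤[ w ] x = x ≢ 0ℚ → T ℤ.≤ w x

_<[_]_ : ℤ → (ℚ → ℤ) → ℚ → Set
T <[ w ] x = x ≢ 0ℚ → T ℤ.< w x

_≡[_]_ : ℤ → (ℚ → ℤ) → ℚ → Set
T ≡[ w ] x = x ≢ 0ℚ × w x ≡ T

*-≢0⁻¹ : ∀ {x y} → x * y ≢ 0ℚ → x ≢ 0ℚ × y ≢ 0ℚ
*-≢0⁻¹ {x} {y} xy≢0 = (λ { refl → xy≢0 (ℚP.*-zeroˡ y) }) , (λ { refl → xy≢0 (ℚP.*-zeroʳ x) })

sumUpTo : (ℕ → ℚ) → ℕ → ℚ
sumUpTo t zero    = t 0
sumUpTo t (suc m) = sumUpTo t m + t (suc m)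

module _ {w : ℚ → ℤ} (U : Ultrametric w) where
  open Ultrametric U

  ≤[]-+ : ∀ {T x y} → T ≤[ w ] x → T ≤[ w ] y → T ≤[ w ] x + y
  ≤[]-+ {T} {x} {y} Tx Ty x+y≢0 with x ℚP.≟ 0ℚ | y ℚP.≟ 0ℚ
  ... | yes refl | _ = subst (λ z → T ℤ.≤ w z) (sym (ℚP.+-identityˡ y)) (Ty (λ { refl → x+y≢0 refl }))
  ... | no _ | yes refl = subst (λ z → T ℤ.≤ w z) (sym (ℚP.+-identityʳ x)) (Tx (λ { refl → x+y≢0 refl }))
  ... | no x≢0 | no y≢0 with +-≥ x≢0 y≢0 x+y≢0
  ...   | inj₁ wx≤ = ℤP.≤-trans (Tx x≢0) wx≤
  ...   | inj₂ wy≤ = ℤP.≤-trans (Ty y≢0) wy≤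

  <[]-+ : ∀ {T x y} → T <[ w ] x → T <[ w ] y → T <[ w ] x + y
  <[]-+ {T} {x} {y} Tx Ty x+y≢0 with x ℚP.≟ 0ℚ | y ℚP.≟ 0ℚ
  ... | yes refl | _ = subst (λ z → T ℤ.< w z) (sym (ℚP.+-identityˡ y)) (Ty (λ { refl → x+y≢0 refl }))
  ... | no _ | yes refl = subst (λ z → T ℤ.< w z) (sym (ℚP.+-identityʳ x)) (Tx (λ { refl → x+y≢0 refl }))
  ... | no x≢0 | no y≢0 with +-≥ x≢0 y≢0 x+y≢0
  ...   | inj₁ wx≤ = ℤP.<-≤-trans (Tx x≢0) wx≤
  ...   | inj₂ wy≤ = ℤP.<-≤-trans (Ty y≢0) wy≤

  ≡[]-+ : ∀ {T x y} → T ≡[ w ] x → T <[ w ] y → T ≡[ w ] x + y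
  ≡[]-+ {T} {x} {y} (x≢0 , wx≡T) Ty with y ℚP.≟ 0ℚ
  ... | yes refl = subst (T ≡[ w ]_) (sym (ℚP.+-identityʳ x)) (x≢0 , wx≡T)
  ... | no y≢0 with +-< x≢0 y≢0 (subst (ℤ._< w y) (sym wx≡T) (Ty y≢0))
  ...   | x+y≢0 , e = x+y≢0 , trans e wx≡T

  ≡[]-+ʳ : ∀ {T x y} → T <[ w ] x → T ≡[ w ] y → T ≡[ w ] x + y
  ≡[]-+ʳ {T} {x} {y} Tx Ty = subst (T ≡[ w ]_) (ℚP.+-comm y x) (≡[]-+ Ty Tx)

  sumUpTo-<[] : ∀ {T} t m → (∀ i → i ℕ.≤ m → T <[ w ] t i) → T <[ w ] sumUpTo t m
  sumUpTo-<[] t zero    Tt = Tt 0 z≤n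
  sumUpTo-<[] t (suc m) Tt = <[]-+ (sumUpTo-<[] t m (λ i i≤m → Tt i (ℕP.m≤n⇒m≤1+n i≤m))) (Tt (suc m) ℕP.≤-refl)

  sumUpTo-≡[] : ∀ {T} t m {i} → i ℕ.≤ m → T ≡[ w ] t i → (∀ j → j ℕ.≤ m → j ≢ i → T <[ w ] t j) →
                T ≡[ w ] sumUpTo t m
  sumUpTo-≡[] t zero    z≤n Tti Ttj = Tti
  sumUpTo-≡[] t (suc m) {i} i≤1+m Tti Ttj with i ℕ.≟ suc m
  ... | yes refl = ≡[]-+ʳ (sumUpTo-<[] t m (λ j j≤m → Ttj j (ℕP.m≤n⇒m≤1+n j≤m) (ℕP.<⇒≢ (s≤s j≤m))))
                          Tti
  ... | no i≢1+m = ≡[]-+ (sumUpTo-≡[] t m (ℕP.m<1+n⇒m≤n (ℕP.≤∧≢⇒< i≤1+m i≢1+m)) Tti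
                            (λ j j≤m → Ttj j (ℕP.m≤n⇒m≤1+n j≤m)))
                         (Ttj (suc m) ℕP.≤-refl (λ e → i≢1+m (sym e)))

coeff-+ : ∀ p q i → coeff (p +ₚ q) i ≡ coeff p i + coeff q i
coeff-+ []      q       i       = sym (ℚP.+-identityˡ _)
coeff-+ (a ∷ p) []      i       = sym (ℚP.+-identityʳ _)
coeff-+ (a ∷ p) (b ∷ q) zero    = refl
coeff-+ (a ∷ p) (b ∷ q) (suc i) = coeff-+ p q i

coeff-· : ∀ c p i → coeff (c ·ₚ p) i ≡ c * coeff p i
coeff-· c []      i       = sym (ℚP.*-zeroʳ c)
coeff-· c (a ∷ p) zero    = refl
coeff-· c (a ∷ p) (suc i) = coeff-· c p i

coeff-≥length : ∀ p {i} → length p ℕ.≤ i → coeff p i ≡ 0ℚ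
coeff-≥length []      _         = refl
coeff-≥length (a ∷ p) (s≤s len≤i) = coeff-≥length p len≤i

sumUpTo-suc : ∀ t k → sumUpTo t (suc k) ≡ t 0 + sumUpTo (λ i → t (suc i)) k
sumUpTo-suc t zero    = refl
sumUpTo-suc t (suc k) = trans (cong (_+ t (suc (suc k))) (sumUpTo-suc t k)) (ℚP.+-assoc (t 0) _ _)

sumUpTo-zero : ∀ t k → (∀ i → t i ≡ 0ℚ) → sumUpTo t k ≡ 0ℚ
sumUpTo-zero t zero    t≡0 = t≡0 0
sumUpTo-zero t (suc k) t≡0 = cong₂ _+_ (sumUpTo-zero t k t≡0) (t≡0 (suc k))

coeff-* : ∀ p q k → coeff (p *ₚ q) k ≡ sumUpTo (λ i → coeff p i * coeff q (k ℕ.∸ i)) k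
coeff-* []      q k       = sym (sumUpTo-zero _ k (λ i → ℚP.*-zeroˡ (coeff q (k ℕ.∸ i))))
coeff-* (a ∷ p) q zero    =
  trans (coeff-+ (a ·ₚ q) (0ℚ ∷ (p *ₚ q)) 0) (trans (ℚP.+-identityʳ _) (coeff-· a q 0))
coeff-* (a ∷ p) q (suc k) = begin
  coeff ((a ∷ p) *ₚ q) (suc k)
    ≡⟨ coeff-+ (a ·ₚ q) (0ℚ ∷ (p *ₚ q)) (suc k) ⟩
  coeff (a ·ₚ q) (suc k) + coeff (p *ₚ q) k
    ≡⟨ cong₂ _+_ (coeff-· a q (suc k)) (coeff-* p q k) ⟩
  a * coeff q (suc k) + sumUpTo (λ i → coeff p i * coeff q (k ℕ.∸ i)) k
    ≡⟨ sym (sumUpTo-suc (λ i → coeff (a ∷ p) i * coeff q (suc k ℕ.∸ i)) k) ⟩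
  sumUpTo (λ i → coeff (a ∷ p) i * coeff q (suc k ℕ.∸ i)) (suc k) ∎
  where open ≡-Reasoning

-- Dumas' irreducibility criterion

module _ {P : ℕ → Set} (P? : Decidable P) {_≺_ : ℕ → ℕ → Set}
         (≺-trans : ∀ {i j k} → i ≺ j → j ≺ k → i ≺ k)
         (≺-connex : ∀ {i j} → i ≢ j → i ≺ j ⊎ j ≺ i) where

  Beats : ℕ → ℕ → Set
  Beats i j = P j → j ≢ i → i ≺ j

  private
    below-suc : ∀ {L} {Q : ℕ → Set} → (∀ {j} → j ℕ.< L → Q j) → Q L → ∀ {j} → j ℕ.< suc L → Q j
    below-suc below at j<1+L with ℕP.m<1+n⇒m<n∨m≡n j<1+L
    ... | inj₁ j<L  = below j<L
    ... | inj₂ refl = at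

    beats-self : ∀ {i} → Beats i i
    beats-self _ i≢i = ⊥-elim (i≢i refl)

    LeastBelow : ℕ → Set
    LeastBelow L = ∃[ i ] i ℕ.< L × P i × (∀ {j} → j ℕ.< L → Beats i j)

    search : ∀ L → (∀ {j} → j ℕ.< L → ¬ P j) ⊎ LeastBelow L
    search zero = inj₁ λ ()
    search (suc L) with search L | P? L
    ... | inj₁ none | no ¬PL = inj₁ (below-suc none ¬PL)
    ... | inj₁ none | yes PL =
      inj₂ (L , ℕP.≤-refl , PL , below-suc {Q = Beats L} (λ j<L Pj _ → ⊥-elim (none j<L Pj)) beats-self)
    ... | inj₂ (i , i<L , Pi , beats) | no ¬PL =
      inj₂ (i , ℕP.m<n⇒m<1+n i<L , Pi , below-suc {Q = Beats i} beats (λ PL _ → ⊥-elim (¬PL PL)))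
    ... | inj₂ (i , i<L , Pi , beats) | yes PL with ≺-connex (ℕP.<⇒≢ i<L)
    ...   | inj₁ i≺L = inj₂ (i , ℕP.m<n⇒m<1+n i<L , Pi , below-suc {Q = Beats i} beats (λ _ _ → i≺L))
    ...   | inj₂ L≺i = inj₂ (L , ℕP.≤-refl , PL , below-suc {Q = Beats L} (λ j<L Pj _ → L≺ j<L Pj) beats-self)
      where
      L≺ : ∀ {j} → j ℕ.< L → P j → L ≺ j
      L≺ {j} j<L Pj with j ℕ.≟ i
      ... | yes refl = L≺i
      ... | no j≢i   = ≺-trans L≺i (beats j<L Pj j≢i)

    inside : ∀ {L j} → (∀ {j} → L ℕ.≤ j → ¬ P j) → P j → j ℕ.< L
    inside {L} {j} outside Pj with j ℕ.<? L
    ... | yes j<L = j<L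
    ... | no j≮L  = ⊥-elim (outside (ℕP.≮⇒≥ j≮L) Pj)

  least : ∀ {L a} → (∀ {j} → L ℕ.≤ j → ¬ P j) → P a → ∃[ i ] P i × (∀ {j} → Beats i j)
  least {L} outside Pa with search L
  ... | inj₁ none                 = ⊥-elim (none (inside outside Pa) Pa)
  ... | inj₂ (i , _ , Pi , beats) = i , Pi , λ Pj j≢i → beats (inside outside Pj) Pj j≢i

i+j<k⇒j<k∸i : ∀ {i j k} → i ℕ.≤ k → i ℕ.+ j ℕ.< k → j ℕ.< k ℕ.∸ i
i+j<k⇒j<k∸i {i} {j} {k} i≤k i+j<k = subst (ℕ._< k ℕ.∸ i) (ℕP.m+n∸m≡n i j) (ℕP.∸-monoˡ-< i+j<k (ℕP.m≤m+n i j))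

≡0⇒<[] : ∀ {w T x} → x ≡ 0ℚ → T <[ w ] x
≡0⇒<[] x≡0 x≢0 = ⊥-elim (x≢0 x≡0)

lastNonzero : ∀ p {a} → coeff p a ≢ 0ℚ →
              ∃[ t ] a ℕ.≤ t × coeff p t ≢ 0ℚ × (∀ {j} → t ℕ.< j → coeff p j ≡ 0ℚ)
lastNonzero p {a} pa≢0
  with least (λ j → ¬? (coeff p j ℚP.≟ 0ℚ)) {λ i j → j ℕ.< i} (λ j<i k<j → ℕP.<-trans k<j j<i) >-connex
            (λ len≤j pj≢0 → pj≢0 (coeff-≥length p len≤j)) pa≢0
  where
  >-connex : ∀ {i j} → i ≢ j → j ℕ.< i ⊎ i ℕ.< j
  >-connex {i} {j} i≢j with ℕP.<-cmp i j
  ... | tri< i<j _ _ = inj₂ i<j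
  ... | tri≈ _ i≡j _ = ⊥-elim (i≢j i≡j)
  ... | tri> _ _ j<i = inj₁ j<i
... | t , pt≢0 , after = t , a≤t , pt≢0 , vanish
  where
  a≤t : a ℕ.≤ t
  a≤t with a ℕ.≟ t
  ... | yes refl = ℕP.≤-refl
  ... | no a≢t   = ℕP.<⇒≤ (after pa≢0 a≢t)
  vanish : ∀ {j} → t ℕ.< j → coeff p j ≡ 0ℚ
  vanish {j} t<j with coeff p j ℚP.≟ 0ℚ
  ... | yes pj≡0 = pj≡0
  ... | no pj≢0  = ⊥-elim (ℕP.<-asym t<j (after pj≢0 (λ j≡t → ℕP.<⇒≢ t<j (sym j≡t))))

convolution : Poly → Poly → ℕ → ℕ → ℚ
convolution g h k i = coeff g i * coeff h (k ℕ.∸ i)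

coeff-≈-* : ∀ {f g h} → f ≈ₚ g *ₚ h → ∀ k → coeff f k ≡ sumUpTo (convolution g h k) k
coeff-≈-* {f} {g} {h} f≈gh k = trans (f≈gh k) (coeff-* g h k)

*-nonzero-beyond : ∀ {f g h a b} → f ≈ₚ g *ₚ h → coeff g a ≢ 0ℚ → coeff h b ≢ 0ℚ →
                   ∃[ k ] a ℕ.+ b ℕ.≤ k × coeff f k ≢ 0ℚ
*-nonzero-beyond {f} {g} {h} f≈gh ga≢0 hb≢0 with lastNonzero g ga≢0 | lastNonzero h hb≢0
... | t , a≤t , gt≢0 , g-vanish | u , b≤u , hu≢0 , h-vanish =
  k , ℕP.+-mono-≤ a≤t b≤u , subst (_≢ 0ℚ) (sym (coeff-≈-* {f} {g} {h} f≈gh k)) (proj₁ sum≢0)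
  where
  k = t ℕ.+ u
  term = convolution g h k
  lead : term t ≢ 0ℚ
  lead = subst (λ m → coeff g t * coeff h m ≢ 0ℚ) (sym (ℕP.m+n∸m≡n t u)) (proj₁ (ν-* gt≢0 hu≢0))
  -- All other terms vanish; ν only serves to reuse sumUpTo-≡[].
  rest : ∀ i → i ℕ.≤ k → i ≢ t → ν (term t) <[ ν ] term i
  rest i i≤k i≢t with ℕP.<-cmp i t
  ... | tri< i<t _ _ = ≡0⇒<[] {ν} (trans (cong (coeff g i *_) (h-vanish (i+j<k⇒j<k∸i i≤k (ℕP.+-monoˡ-< u i<t))))
                                      (ℚP.*-zeroʳ (coeff g i)))
  ... | tri≈ _ i≡t _ = ⊥-elim (i≢t i≡t)
  ... | tri> _ _ t<i = ≡0⇒<[] {ν} (trans (cong (_* coeff h (k ℕ.∸ i)) (g-vanish t<i)) (ℚP.*-zeroˡ (coeff h (k ℕ.∸ i))))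
  sum≢0 = sumUpTo-≡[] ν-ultrametric term k (ℕP.m≤m+n t u) (lead , refl) rest

Splits : (ℕ → ℕ → Set) → Set
Splits _⊏_ = ∀ {i j i′ j′} → (i′ ℕ.+ j′) ⊏ (i ℕ.+ j) ⊎ (i′ ℕ.+ j′ ≡ i ℕ.+ j × i′ ≢ i) →
                              i′ ⊏ i ⊎ j′ ⊏ j

<-splits : Splits ℕ._<_
<-splits {i} {j} {i′} {j′} h with ℕP.<-cmp i′ i
... | tri< i′<i _ _  = inj₁ i′<i
... | tri≈ _ refl _ = inj₂ ([ ℕP.+-cancelˡ-< i j′ j , (λ (_ , i≢i) → ⊥-elim (i≢i refl)) ]′ h)
... | tri> _ _ i<i′  = inj₂ (ℕP.≰⇒> λ j≤j′ → ℕP.<⇒≱ (ℕP.+-mono-<-≤ i<i′ j≤j′) sum≤)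
  where
  sum≤ : i′ ℕ.+ j′ ℕ.≤ i ℕ.+ j
  sum≤ = [ ℕP.<⇒≤ , ℕP.≤-reflexive ∘ proj₁ ]′ h

>-splits : Splits (flip ℕ._<_)
>-splits {i} {j} {i′} {j′} = <-splits {i′} {j′} {i} {j} ∘ Sum.map₂ (λ (e , i′≢i) → sym e , i′≢i ∘ sym)

divisor-cases : ∀ {d i} → 1 ℕ.≤ d → d ∣ i → i ℕ.≤ d → i ≡ 0 ⊎ i ≡ d
divisor-cases {d} _ (divides zero refl) _ = inj₁ refl
divisor-cases {d} _ (divides 1 refl) _ = inj₂ (ℕP.+-identityʳ d)
divisor-cases {d} 1≤d (divides (suc (suc q)) refl) i≤d =
  ⊥-elim (ℕP.<⇒≱ (ℕP.m<m+n d (ℕP.≤-trans 1≤d (ℕP.m≤m+n d (q ℕ.* d)))) i≤d)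

module Lex {_⊏_ : ℕ → ℕ → Set} (sto : IsStrictTotalOrder _≡_ _⊏_) (ω : ℕ → ℤ) where
  private
    module ⊏ = IsStrictTotalOrder sto

  _≺_ : ℕ → ℕ → Set
  i ≺ j = ω i ℤ.< ω j ⊎ (ω i ≡ ω j × i ⊏ j)

  ≺-trans : ∀ {i j k} → i ≺ j → j ≺ k → i ≺ k
  ≺-trans {i} {k = k} (inj₁ i<j)       (inj₁ j<k)        = inj₁ (ℤP.<-trans i<j j<k)
  ≺-trans {i} {k = k} (inj₁ i<j)       (inj₂ (e , _))    = inj₁ (subst (ω i ℤ.<_) e i<j)
  ≺-trans {i} {k = k} (inj₂ (e , _))   (inj₁ j<k)        = inj₁ (subst (ℤ._< ω k) (sym e) j<k)
  ≺-trans {i} {k = k} (inj₂ (e , i⊏j)) (inj₂ (e′ , j⊏k)) = inj₂ (trans e e′ , ⊏.trans i⊏j j⊏k)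

  ≺-connex : ∀ {i j} → i ≢ j → i ≺ j ⊎ j ≺ i
  ≺-connex {i} {j} i≢j with ℤP.<-cmp (ω i) (ω j) | ⊏.compare i j
  ... | tri< ωi<ωj _ _ | _            = inj₁ (inj₁ ωi<ωj)
  ... | tri> _ _ ωj<ωi | _            = inj₂ (inj₁ ωj<ωi)
  ... | tri≈ _ e _     | tri< i⊏j _ _ = inj₁ (inj₂ (e , i⊏j))
  ... | tri≈ _ _ _     | tri≈ _ i≡j _ = ⊥-elim (i≢j i≡j)
  ... | tri≈ _ e _     | tri> _ _ j⊏i = inj₂ (inj₂ (sym e , j⊏i))

module Newton (d s : ℕ) where

  -- The points (k, ν x) minimising W k x are those on the face of slope s/d of the Newton polygon.
  W : ℕ → ℚ → ℤ
  W k x = + d ℤ.* ν x ℤ.- + (s ℕ.* k)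

  W-ultrametric : ∀ k → Ultrametric (W k)
  W-ultrametric k = record { +-≥ = ≥ ; +-< = < }
    where
    open Ultrametric ν-ultrametric renaming (+-≥ to ν-+-≥; +-< to ν-+-<)
    mono : ∀ {x y} → ν x ℤ.≤ ν y → W k x ℤ.≤ W k y
    mono νx≤νy = ℤP.+-monoˡ-≤ (ℤ.- + (s ℕ.* k)) (ℤP.*-monoˡ-≤-nonNeg (+ d) νx≤νy)
    ≥ : ∀ {x y} → x ≢ 0ℚ → y ≢ 0ℚ → x + y ≢ 0ℚ → W k x ℤ.≤ W k (x + y) ⊎ W k y ℤ.≤ W k (x + y)
    ≥ x≢0 y≢0 x+y≢0 = Sum.map mono mono (ν-+-≥ x≢0 y≢0 x+y≢0)
    < : ∀ {x y} → x ≢ 0ℚ → y ≢ 0ℚ → W k x ℤ.< W k y → x + y ≢ 0ℚ × W k (x + y) ≡ W k x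
    < x≢0 y≢0 Wx<Wy with ν-+-< x≢0 y≢0 (ℤP.*-cancelˡ-<-nonNeg (+ d) (+-cancelʳ-< (ℤ.- + (s ℕ.* k)) Wx<Wy))
    ... | x+y≢0 , e = x+y≢0 , cong (λ v → + d ℤ.* v ℤ.- + (s ℕ.* k)) e

  W-* : ∀ i j {x y} → x ≢ 0ℚ → y ≢ 0ℚ → x * y ≢ 0ℚ × W (i ℕ.+ j) (x * y) ≡ W i x ℤ.+ W j y
  W-* i j {x} {y} x≢0 y≢0 with ν-* x≢0 y≢0
  ... | xy≢0 , νxy = xy≢0 , (begin
    + d ℤ.* ν (x * y) ℤ.- + (s ℕ.* (i ℕ.+ j))
      ≡⟨ cong₂ (λ v n → + d ℤ.* v ℤ.- + n) νxy (ℕP.*-distribˡ-+ s i j) ⟩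
    + d ℤ.* (ν x ℤ.+ ν y) ℤ.- (+ (s ℕ.* i) ℤ.+ + (s ℕ.* j))
      ≡⟨ regroup (+ d) (ν x) (ν y) (+ (s ℕ.* i)) (+ (s ℕ.* j)) ⟩
    W i x ℤ.+ W j y ∎)
    where
    open ≡-Reasoning
    regroup : ∀ D a b u v → D ℤ.* (a ℤ.+ b) ℤ.- (u ℤ.+ v) ≡ (D ℤ.* a ℤ.- u) ℤ.+ (D ℤ.* b ℤ.- v)
    regroup = solve-∀

  record Extreme (c : ℕ → ℚ) (_⊏_ : ℕ → ℕ → Set) (k : ℕ) (M : ℤ) : Set where
    field
      attained : M ≡[ W k ] c k
      exceeded : ∀ j → j ⊏ k → M <[ W j ] c j

  -- k is the ⊏-extreme point of the face of slope s/d of the Newton polygon of c.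
  record FaceEnd (c : ℕ → ℚ) (_⊏_ : ℕ → ℕ → Set) (k : ℕ) (M : ℤ) : Set where
    field
      extreme : Extreme c _⊏_ k M
      minimal : ∀ j → M ≤[ W j ] c j
    open Extreme extreme public

  faceEnd-weight : ∀ {c ⊏ ⊏′ k k′ M M′} → FaceEnd c ⊏ k M → FaceEnd c ⊏′ k′ M′ → M ≡ M′
  faceEnd-weight e e′ = ℤP.≤-antisym
    (subst (_ ℤ.≤_) (proj₂ (FaceEnd.attained e′)) (FaceEnd.minimal e _ (proj₁ (FaceEnd.attained e′))))
    (subst (_ ℤ.≤_) (proj₂ (FaceEnd.attained e)) (FaceEnd.minimal e′ _ (proj₁ (FaceEnd.attained e))))

  faceEnd : ∀ {_⊏_ c L a} → IsStrictTotalOrder _≡_ _⊏_ → (∀ {j} → L ℕ.≤ j → c j ≡ 0ℚ) → c a ≢ 0ℚ →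
            ∃₂ λ k M → FaceEnd c _⊏_ k M
  faceEnd {_⊏_} {c} sto outside ca≢0
    with least (λ j → ¬? (c j ℚP.≟ 0ℚ)) (Lex.≺-trans sto ω) (Lex.≺-connex sto ω)
               (λ L≤j cj≢0 → cj≢0 (outside L≤j)) ca≢0
    where
    ω : ℕ → ℤ
    ω j = W j (c j)
  ... | k , ck≢0 , beats = k , W k (c k) , record
    { extreme = record { attained = ck≢0 , refl ; exceeded = exceeded }
    ; minimal = minimal }
    where
    module ⊏ = IsStrictTotalOrder sto
    minimal : ∀ j → W k (c k) ≤[ W j ] c j
    minimal j cj≢0 with j ℕ.≟ k
    ... | yes refl = ℤP.≤-refl
    ... | no j≢k   = [ ℤP.<⇒≤ , ℤP.≤-reflexive ∘ proj₁ ]′ (beats cj≢0 j≢k)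
    exceeded : ∀ j → j ⊏ k → W k (c k) <[ W j ] c j
    exceeded j j⊏k cj≢0 with beats cj≢0 (λ j≡k → ⊏.irrefl j≡k j⊏k)
    ... | inj₁ ωk<ωj      = ωk<ωj
    ... | inj₂ (_ , k⊏j) = ⊥-elim (⊏.asym k⊏j j⊏k)

  -- Dumas: the ⊏-ends of the faces of g and h add up to the ⊏-end of the face of g h.
  extreme-* : ∀ {f g h _⊏_ i j Mg Mh} → Splits _⊏_ → f ≈ₚ g *ₚ h →
              FaceEnd (coeff g) _⊏_ i Mg → FaceEnd (coeff h) _⊏_ j Mh → Extreme (coeff f) _⊏_ (i ℕ.+ j) (Mg ℤ.+ Mh)
  extreme-* {f} {g} {h} {_⊏_} {i} {j} {Mg} {Mh} splits f≈gh endg endh = record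
    { attained = subst (Mg ℤ.+ Mh ≡[ W (i ℕ.+ j) ]_) (sym (coeff-≈-* {f} {g} {h} f≈gh (i ℕ.+ j)))
        (sumUpTo-≡[] (W-ultrametric (i ℕ.+ j)) (convolution g h (i ℕ.+ j)) (i ℕ.+ j) (ℕP.m≤m+n i j) lead
          (λ i′ i′≤k i′≢i → term-exceeds i′≤k (splits (inj₂ (ℕP.m+[n∸m]≡n i′≤k , i′≢i)))))
    ; exceeded = λ k k⊏i+j → subst (Mg ℤ.+ Mh <[ W k ]_) (sym (coeff-≈-* {f} {g} {h} f≈gh k))
        (sumUpTo-<[] (W-ultrametric k) (convolution g h k) k
          (λ i′ i′≤k → term-exceeds i′≤k
                         (splits (inj₁ (subst (_⊏ (i ℕ.+ j)) (sym (ℕP.m+[n∸m]≡n i′≤k)) k⊏i+j)))))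
    }
    where
    module G = FaceEnd endg
    module H = FaceEnd endh
    term-exceeds : ∀ {k i′} → i′ ℕ.≤ k → i′ ⊏ i ⊎ (k ℕ.∸ i′) ⊏ j →
                   Mg ℤ.+ Mh <[ W k ] convolution g h k i′
    term-exceeds {k} {i′} i′≤k side t≢0 with *-≢0⁻¹ t≢0
    ... | gi′≢0 , hj′≢0 = subst (Mg ℤ.+ Mh ℤ.<_) weight
          ([ (λ i′⊏i → ℤP.+-mono-<-≤ (G.exceeded i′ i′⊏i gi′≢0) (H.minimal _ hj′≢0))
           , (λ j′⊏j → ℤP.+-mono-≤-< (G.minimal i′ gi′≢0) (H.exceeded _ j′⊏j hj′≢0)) ]′ side)
      where
      weight : W i′ (coeff g i′) ℤ.+ W (k ℕ.∸ i′) (coeff h (k ℕ.∸ i′)) ≡ W k (convolution g h k i′)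
      weight = trans (sym (proj₂ (W-* i′ (k ℕ.∸ i′) gi′≢0 hj′≢0)))
                     (cong (λ m → W m (convolution g h k i′)) (ℕP.m+[n∸m]≡n i′≤k))
    lead : Mg ℤ.+ Mh ≡[ W (i ℕ.+ j) ] convolution g h (i ℕ.+ j) i
    lead = subst (λ m → Mg ℤ.+ Mh ≡[ W (i ℕ.+ j) ] coeff g i * coeff h m) (sym (ℕP.m+n∸m≡n i j))
             (map₂ (λ e → trans e (cong₂ ℤ._+_ (proj₂ G.attained) (proj₂ H.attained)))
               (W-* i j (proj₁ G.attained) (proj₁ H.attained)))

  -- The Newton polygon of c is the single segment of slope s/d from index 0 to index d.
  record Segment (c : ℕ → ℚ) (A : ℤ) : Set where
    field
      start    : A ≡[ W 0 ] c 0
      end      : A ≡[ W d ] c d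
      interior : ∀ k → 0 ℕ.< k → k ℕ.< d → A <[ W k ] c k
      beyond   : ∀ k → d ℕ.< k → c k ≡ 0ℚ

    degree≤ : ∀ {k} → c k ≢ 0ℚ → k ℕ.≤ d
    degree≤ {k} ck≢0 = ℕP.≮⇒≥ (λ d<k → ck≢0 (beyond k d<k))

    lowerBound : ∀ k → A ≤[ W k ] c k
    lowerBound zero      _     = ℤP.≤-reflexive (sym (proj₂ start))
    lowerBound k@(suc _) ck≢0 with ℕP.<-cmp k d
    ... | tri< k<d _ _  = ℤP.<⇒≤ (interior k (s≤s z≤n) k<d ck≢0)
    ... | tri≈ _ refl _ = ℤP.≤-reflexive (sym (proj₂ end))
    ... | tri> _ _ d<k  = ⊥-elim (ck≢0 (beyond k d<k))

    lowest : ∀ {k M} → Extreme c ℕ._<_ k M → k ≡ 0 × M ≡ A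
    lowest {zero} e = refl , trans (sym (proj₂ (Extreme.attained e))) (proj₂ start)
    lowest {suc k} {M} e = ⊥-elim (ℤP.<⇒≱ M<A A≤M)
      where
      M<A : M ℤ.< A
      M<A = subst (M ℤ.<_) (proj₂ start) (Extreme.exceeded e 0 (s≤s z≤n) (proj₁ start))
      A≤M : A ℤ.≤ M
      A≤M = subst (A ℤ.≤_) (proj₂ (Extreme.attained e)) (lowerBound (suc k) (proj₁ (Extreme.attained e)))

    highest : ∀ {k} → Extreme c (flip ℕ._<_) k A → k ≡ d
    highest {k} e with ℕP.<-cmp k d
    ... | tri< k<d _ _ = ⊥-elim (ℤP.<-irrefl (sym (proj₂ end)) (Extreme.exceeded e d k<d (proj₁ end)))
    ... | tri≈ _ k≡d _ = k≡d
    ... | tri> _ _ d<k = ⊥-elim (proj₁ (Extreme.attained e) (beyond k d<k))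

  equal-weights⇒∣ : ∀ {x y i} → W 0 x ≡ W i y → d ∣ s ℕ.* i
  equal-weights⇒∣ {x} {y} {i} e = divides ∣ ν y ℤ.- ν x ∣ (begin
    ∣ + (s ℕ.* i) ∣            ≡⟨ cong ∣_∣ si≡ ⟩
    ∣ + d ℤ.* (ν y ℤ.- ν x) ∣  ≡⟨ ℤP.abs-* (+ d) (ν y ℤ.- ν x) ⟩
    d ℕ.* ∣ ν y ℤ.- ν x ∣      ≡⟨ ℕP.*-comm d _ ⟩
    ∣ ν y ℤ.- ν x ∣ ℕ.* d      ∎)
    where
    open ≡-Reasoning
    isolate : ∀ D a b Z S → D ℤ.* a ℤ.- Z ≡ D ℤ.* b ℤ.- S → S ≡ D ℤ.* (b ℤ.- a) ℤ.+ Z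
    isolate D a b Z S e = begin
      S                ≡⟨ expand D a b Z S ⟩
      R ℤ.+ (l ℤ.- r)  ≡⟨ cong (λ t → R ℤ.+ (t ℤ.- r)) e ⟩
      R ℤ.+ (r ℤ.- r)  ≡⟨ cong (ℤ._+_ R) (ℤP.+-inverseʳ r) ⟩
      R ℤ.+ 0ℤ         ≡⟨ ℤP.+-identityʳ R ⟩
      R                ∎
      where
      R = D ℤ.* (b ℤ.- a) ℤ.+ Z
      l = D ℤ.* a ℤ.- Z
      r = D ℤ.* b ℤ.- S
      expand : ∀ D a b Z S → S ≡ D ℤ.* (b ℤ.- a) ℤ.+ Z ℤ.+ ((D ℤ.* a ℤ.- Z) ℤ.- (D ℤ.* b ℤ.- S))
      expand = solve-∀
    si≡ : + (s ℕ.* i) ≡ + d ℤ.* (ν y ℤ.- ν x)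
    si≡ = trans (isolate (+ d) (ν x) (ν y) (+ (s ℕ.* 0)) (+ (s ℕ.* i)) e)
                (trans (cong (λ n → + d ℤ.* (ν y ℤ.- ν x) ℤ.+ + n) (ℕP.*-zeroʳ s)) (ℤP.+-identityʳ _))

  module _ (1≤d : 1 ℕ.≤ d) (d⊥s : Coprime d s) {p A} (segment : Segment (coeff p) A) where
    open Segment segment

    private
      >-sto : IsStrictTotalOrder _≡_ (flip ℕ._<_)
      >-sto = Flip.isStrictTotalOrder ℕP.<-isStrictTotalOrder

      product-degree≤ : ∀ {g h a b} → p ≈ₚ g *ₚ h → coeff g a ≢ 0ℚ → coeff h b ≢ 0ℚ → a ℕ.+ b ℕ.≤ d
      product-degree≤ {g} {h} p≈gh ga≢0 hb≢0 with *-nonzero-beyond {p} {g} {h} p≈gh ga≢0 hb≢0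
      ... | k , a+b≤k , pk≢0 = ℕP.≤-trans a+b≤k (degree≤ pk≢0)

      module Factorisation {g h} (p≈gh : p ≈ₚ g *ₚ h) {i₀ j₀ i₁ j₁ Mg Mh Mg′ Mh′}
                           (G₀ : FaceEnd (coeff g) ℕ._<_ i₀ Mg) (H₀ : FaceEnd (coeff h) ℕ._<_ j₀ Mh)
                           (G₁ : FaceEnd (coeff g) (flip ℕ._<_) i₁ Mg′) (H₁ : FaceEnd (coeff h) (flip ℕ._<_) j₁ Mh′) where

        lowEnds : i₀ ℕ.+ j₀ ≡ 0 × Mg ℤ.+ Mh ≡ A
        lowEnds = lowest (extreme-* {p} {g} {h} <-splits p≈gh G₀ H₀)

        i₁+j₁≡d : i₁ ℕ.+ j₁ ≡ d
        i₁+j₁≡d = highest (subst (Extreme (coeff p) (flip ℕ._<_) (i₁ ℕ.+ j₁)) sameWeight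
                                 (extreme-* {p} {g} {h} >-splits p≈gh G₁ H₁))
          where
          sameWeight = trans (cong₂ ℤ._+_ (faceEnd-weight G₁ G₀) (faceEnd-weight H₁ H₀)) (proj₂ lowEnds)

        equalWeights : W 0 (coeff g 0) ≡ W i₁ (coeff g i₁)
        equalWeights = begin
          W 0 (coeff g 0)    ≡⟨ cong (λ k → W k (coeff g k)) (sym (ℕP.m+n≡0⇒m≡0 i₀ (proj₁ lowEnds))) ⟩
          W i₀ (coeff g i₀)  ≡⟨ proj₂ (FaceEnd.attained G₀) ⟩
          Mg                 ≡⟨ faceEnd-weight G₀ G₁ ⟩
          Mg′                ≡⟨ sym (proj₂ (FaceEnd.attained G₁)) ⟩
          W i₁ (coeff g i₁)  ∎
          where open ≡-Reasoning

        impossible : ∀ {a b} → 1 ℕ.≤ a → coeff g a ≢ 0ℚ → 1 ℕ.≤ b → coeff h b ≢ 0ℚ → ⊥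
        impossible 1≤a ga≢0 1≤b hb≢0
          with divisor-cases 1≤d (coprime-divisor d⊥s (equal-weights⇒∣ equalWeights))
                             (ℕP.m+n≤o⇒m≤o i₁ (ℕP.≤-reflexive i₁+j₁≡d))
        ... | inj₁ i₁≡0 = ℕP.<-irrefl refl (ℕP.≤-trans (ℕP.+-monoˡ-≤ d 1≤a) (product-degree≤ {g} {h} p≈gh ga≢0 hd≢0))
          where
          hd≢0 : coeff h d ≢ 0ℚ
          hd≢0 = subst (λ j → coeff h j ≢ 0ℚ) (trans (sym (cong (ℕ._+ j₁) i₁≡0)) i₁+j₁≡d) (proj₁ (FaceEnd.attained H₁))
        ... | inj₂ i₁≡d = ℕP.<⇒≱ (ℕP.m<m+n d 1≤b) (product-degree≤ {g} {h} p≈gh gd≢0 hb≢0)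
          where
          gd≢0 : coeff g d ≢ 0ℚ
          gd≢0 = subst (λ i → coeff g i ≢ 0ℚ) i₁≡d (proj₁ (FaceEnd.attained G₁))

    dumas : Irreducible p
    dumas = (d , 1≤d , proj₁ end) , no-factorisation
      where
      no-factorisation : ∀ g h → p ≈ₚ g *ₚ h → ¬ (NonConstant g × NonConstant h)
      no-factorisation g h p≈gh ((a , 1≤a , ga≢0) , (b , 1≤b , hb≢0))
        with faceEnd ℕP.<-isStrictTotalOrder (coeff-≥length g) ga≢0 | faceEnd ℕP.<-isStrictTotalOrder (coeff-≥length h) hb≢0
           | faceEnd >-sto (coeff-≥length g) ga≢0 | faceEnd >-sto (coeff-≥length h) hb≢0
      ... | _ , _ , G₀ | _ , _ , H₀ | _ , _ , G₁ | _ , _ , H₁ =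
        Factorisation.impossible {g} {h} p≈gh G₀ H₀ G₁ H₁ 1≤a ga≢0 1≤b hb≢0

-- The polynomials K a n

1−X : Poly
1−X = const 1ℚ +ₚ (- 1ℚ) ·ₚ X

coeff-linear-*-zero : ∀ a b p → coeff ((a ∷ b ∷ []) *ₚ p) 0 ≡ a * coeff p 0
coeff-linear-*-zero a b p = trans (coeff-+ (a ·ₚ p) _ 0) (trans (ℚP.+-identityʳ _) (coeff-· a p 0))

coeff-linear-*-suc : ∀ a b p k → coeff ((a ∷ b ∷ []) *ₚ p) (suc k) ≡ a * coeff p (suc k) + b * coeff p k
coeff-linear-*-suc a b p k = begin
  coeff ((a ∷ b ∷ []) *ₚ p) (suc k)
    ≡⟨ coeff-+ (a ·ₚ p) _ (suc k) ⟩
  coeff (a ·ₚ p) (suc k) + coeff (b ·ₚ p +ₚ (0ℚ ∷ [])) k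
    ≡⟨ cong₂ _+_ (coeff-· a p (suc k)) (coeff-+ (b ·ₚ p) (0ℚ ∷ []) k) ⟩
  a * coeff p (suc k) + (coeff (b ·ₚ p) k + coeff (0ℚ ∷ []) k)
    ≡⟨ cong (λ z → a * coeff p (suc k) + z) (cong₂ _+_ (coeff-· b p k) (coeff-0 k)) ⟩
  a * coeff p (suc k) + (b * coeff p k + 0ℚ)
    ≡⟨ cong (_+_ (a * coeff p (suc k))) (ℚP.+-identityʳ _) ⟩
  a * coeff p (suc k) + b * coeff p k ∎
  where
  open ≡-Reasoning
  coeff-0 : ∀ k → coeff (0ℚ ∷ []) k ≡ 0ℚ
  coeff-0 zero    = refl
  coeff-0 (suc k) = refl

coeff-X*-zero : ∀ p → coeff (X *ₚ p) 0 ≡ 0ℚ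
coeff-X*-zero p = trans (coeff-linear-*-zero 0ℚ 1ℚ p) (ℚP.*-zeroˡ (coeff p 0))

coeff-X*-suc : ∀ p k → coeff (X *ₚ p) (suc k) ≡ coeff p k
coeff-X*-suc p k = trans (coeff-linear-*-suc 0ℚ 1ℚ p k)
  (trans (cong₂ _+_ (ℚP.*-zeroˡ (coeff p (suc k))) (ℚP.*-identityˡ (coeff p k))) (ℚP.+-identityˡ (coeff p k)))

coeff-X^-diag : ∀ n → coeff (X ^ₚ n) n ≡ 1ℚ
coeff-X^-diag zero    = refl
coeff-X^-diag (suc n) = trans (coeff-X*-suc (X ^ₚ n) n) (coeff-X^-diag n)

coeff-X^-off : ∀ n {k} → k ≢ n → coeff (X ^ₚ n) k ≡ 0ℚ
coeff-X^-off zero    {zero}  k≢n = ⊥-elim (k≢n refl)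
coeff-X^-off zero    {suc k} _   = refl
coeff-X^-off (suc n) {zero}  _   = coeff-X*-zero (X ^ₚ n)
coeff-X^-off (suc n) {suc k} k≢n = trans (coeff-X*-suc (X ^ₚ n) k) (coeff-X^-off n (k≢n ∘ cong suc))

coeff-1−X*-zero : ∀ p → coeff (1−X *ₚ p) 0 ≡ coeff p 0
coeff-1−X*-zero p = trans (coeff-linear-*-zero 1ℚ (- 1ℚ) p) (ℚP.*-identityˡ (coeff p 0))

coeff-1−X*-suc : ∀ p k → coeff (1−X *ₚ p) (suc k) ≡ coeff p (suc k) + - 1ℚ * coeff p k
coeff-1−X*-suc p k = trans (coeff-linear-*-suc 1ℚ (- 1ℚ) p k) (cong (_+ - 1ℚ * coeff p k) (ℚP.*-identityˡ (coeff p (suc k))))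

coeff-1−X^-zero : ∀ n → coeff (1−X ^ₚ n) 0 ≡ 1ℚ
coeff-1−X^-zero zero    = refl
coeff-1−X^-zero (suc n) = trans (coeff-1−X*-zero (1−X ^ₚ n)) (coeff-1−X^-zero n)

coeff-1−X^-beyond : ∀ n {k} → n ℕ.< k → coeff (1−X ^ₚ n) k ≡ 0ℚ
coeff-1−X^-beyond zero    {suc k} _         = refl
coeff-1−X^-beyond (suc n) {suc k} (s≤s n<k) = trans (coeff-1−X*-suc (1−X ^ₚ n) k)
  (cong₂ (λ u v → u + - 1ℚ * v) (coeff-1−X^-beyond n (ℕP.m<n⇒m<1+n n<k)) (coeff-1−X^-beyond n n<k))

coeff-1−X^-top : ∀ n → coeff (1−X ^ₚ n) n ≡ (- 1ℚ) ^ℚ n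
coeff-1−X^-top zero    = refl
coeff-1−X^-top (suc n) = trans (coeff-1−X*-suc (1−X ^ₚ n) n)
  (trans (cong₂ (λ u v → u + - 1ℚ * v) (coeff-1−X^-beyond n (ℕP.n<1+n n)) (coeff-1−X^-top n))
         (ℚP.+-identityˡ _))

fromℕ : ℕ → ℚ
fromℕ zero    = 0ℚ
fromℕ (suc n) = 1ℚ + fromℕ n

coeff-1−X^-subtop : ∀ m → coeff (1−X ^ₚ suc m) m ≡ (- 1ℚ) ^ℚ m * fromℕ (suc m)
coeff-1−X^-subtop zero    = refl
coeff-1−X^-subtop (suc m) = begin
  coeff (1−X ^ₚ suc (suc m)) (suc m)
    ≡⟨ coeff-1−X*-suc (1−X ^ₚ suc m) m ⟩
  coeff (1−X ^ₚ suc m) (suc m) + - 1ℚ * coeff (1−X ^ₚ suc m) m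
    ≡⟨ cong₂ (λ u v → u + - 1ℚ * v) (coeff-1−X^-top (suc m)) (coeff-1−X^-subtop m) ⟩
  u + - 1ℚ * ((- 1ℚ) ^ℚ m * N)
    ≡⟨ cong (_+_ u) (sym (ℚP.*-assoc (- 1ℚ) ((- 1ℚ) ^ℚ m) N)) ⟩
  u + u * N
    ≡⟨ cong (_+ u * N) (sym (ℚP.*-identityʳ u)) ⟩
  u * 1ℚ + u * N
    ≡⟨ sym (ℚP.*-distribˡ-+ u 1ℚ N) ⟩
  u * fromℕ (suc (suc m)) ∎
  where
  open ≡-Reasoning
  u = (- 1ℚ) ^ℚ suc m
  N = fromℕ (suc m)

≤[ν]-* : ∀ {T U x y} → T ≤[ ν ] x → U ≤[ ν ] y → T ℤ.+ U ≤[ ν ] x * y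
≤[ν]-* {T} {U} Tx Uy xy≢0 with *-≢0⁻¹ xy≢0
... | x≢0 , y≢0 = subst (T ℤ.+ U ℤ.≤_) (sym (proj₂ (ν-* x≢0 y≢0))) (ℤP.+-mono-≤ (Tx x≢0) (Uy y≢0))

coeff-1−X^-integral : ∀ n k → 0ℤ ≤[ ν ] coeff (1−X ^ₚ n) k
coeff-1−X^-integral zero    zero    _   = ℤP.≤-reflexive (sym ν-1)
coeff-1−X^-integral zero    (suc k) 0≢0 = ⊥-elim (0≢0 refl)
coeff-1−X^-integral (suc n) zero    = subst (0ℤ ≤[ ν ]_) (sym (coeff-1−X*-zero (1−X ^ₚ n)))
                                            (coeff-1−X^-integral n 0)
coeff-1−X^-integral (suc n) (suc k) = subst (0ℤ ≤[ ν ]_) (sym (coeff-1−X*-suc (1−X ^ₚ n) k))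
  (≤[]-+ ν-ultrametric {0ℤ} {coeff (1−X ^ₚ n) (suc k)} { - 1ℚ * coeff (1−X ^ₚ n) k}
    (coeff-1−X^-integral n (suc k))
    (≤[ν]-* {0ℤ} {0ℤ} { - 1ℚ} (λ _ → ℤP.≤-reflexive (sym ν-[-1])) (coeff-1−X^-integral n k)))

fromℕ-+ : ∀ m n → fromℕ (m ℕ.+ n) ≡ fromℕ m + fromℕ n
fromℕ-+ zero    n = sym (ℚP.+-identityˡ (fromℕ n))
fromℕ-+ (suc m) n = trans (cong (_+_ 1ℚ) (fromℕ-+ m n)) (sym (ℚP.+-assoc 1ℚ (fromℕ m) (fromℕ n)))

fromℕ-integral : ∀ n → 0ℤ ≤[ ν ] fromℕ n
fromℕ-integral zero    0≢0 = ⊥-elim (0≢0 refl)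
fromℕ-integral (suc n) = ≤[]-+ ν-ultrametric {0ℤ} {1ℚ} {fromℕ n} (λ _ → ℤP.≤-reflexive (sym ν-1)) (fromℕ-integral n)

fromℕ-odd : ∀ t → 0ℤ ≡[ ν ] fromℕ (suc (t ℕ.+ t))
fromℕ-odd t = subst (λ z → 0ℤ ≡[ ν ] 1ℚ + z) (sym double)
  (≡[]-+ ν-ultrametric {0ℤ} {1ℚ} {(1ℚ + 1ℚ) * fromℕ t} ((λ ()) , ν-1)
    (λ 2t≢0 → ℤP.<-≤-trans (ℤ.+<+ (s≤s z≤n)) (two-divides 2t≢0)))
  where
  double : fromℕ (t ℕ.+ t) ≡ (1ℚ + 1ℚ) * fromℕ t
  double = trans (fromℕ-+ t t) (trans (cong₂ _+_ (sym (ℚP.*-identityˡ (fromℕ t))) (sym (ℚP.*-identityˡ (fromℕ t))))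
                                      (sym (ℚP.*-distribʳ-+ (fromℕ t) 1ℚ 1ℚ)))
  two-divides : 1ℤ ≤[ ν ] (1ℚ + 1ℚ) * fromℕ t
  two-divides = ≤[ν]-* {1ℤ} {0ℤ} {1ℚ + 1ℚ} (λ _ → ℤP.≤-reflexive (sym ν-2)) (fromℕ-integral t)

-1^[t+t]≡1 : ∀ t → (- 1ℚ) ^ℚ (t ℕ.+ t) ≡ 1ℚ
-1^[t+t]≡1 zero    = refl
-1^[t+t]≡1 (suc t) = begin
  (- 1ℚ) ^ℚ (suc t ℕ.+ suc t)             ≡⟨ cong (λ m → (- 1ℚ) ^ℚ suc m) (ℕP.+-suc t t) ⟩
  - 1ℚ * (- 1ℚ * (- 1ℚ) ^ℚ (t ℕ.+ t))     ≡⟨ sym (ℚP.*-assoc (- 1ℚ) (- 1ℚ) ((- 1ℚ) ^ℚ (t ℕ.+ t))) ⟩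
  1ℚ * (- 1ℚ) ^ℚ (t ℕ.+ t)                ≡⟨ ℚP.*-identityˡ _ ⟩
  (- 1ℚ) ^ℚ (t ℕ.+ t)                     ≡⟨ -1^[t+t]≡1 t ⟩
  1ℚ                                      ∎
  where open ≡-Reasoning

^ℚ-≡[ν] : ∀ {T x} n → T ≡[ ν ] x → + n ℤ.* T ≡[ ν ] x ^ℚ n
^ℚ-≡[ν] {T} zero    _ = (λ ()) , trans ν-1 (sym (ℤP.*-zeroˡ T))
^ℚ-≡[ν] {T} {x} (suc n) (x≢0 , νx≡T) with ^ℚ-≡[ν] n (x≢0 , νx≡T)
... | xⁿ≢0 , νxⁿ≡nT with ν-* x≢0 xⁿ≢0
...   | xⁿ⁺¹≢0 , ν* = xⁿ⁺¹≢0 , trans ν* (trans (cong₂ ℤ._+_ νx≡T νxⁿ≡nT) (sym (suc-* (+ n) T)))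
  where
  suc-* : ∀ N T → (1ℤ ℤ.+ N) ℤ.* T ≡ T ℤ.+ N ℤ.* T
  suc-* = solve-∀

coprime-suc : ∀ n → Coprime n (suc n)
coprime-suc n = subst (Coprime n) (ℕP.+-comm n 1) (Coprime.sym (coprime-+ (1-coprimeTo n)))

module _ (d s : ℕ) where
  open Newton d s

  integralSegment : ∀ {c e} → ℤ.- + e ≡[ ν ] c 0 → + s ℤ.- + e ≡[ ν ] c d →
                    (∀ k → 0 ℕ.< k → k ℕ.< d → 0ℤ ≤[ ν ] c k) → (∀ k → k ℕ.< d → s ℕ.* k ℕ.< d ℕ.* e) →
                    (∀ k → d ℕ.< k → c k ≡ 0ℚ) → Segment c (ℤ.- + (d ℕ.* e))
  integralSegment {c} {e} (c₀≢0 , νc₀) (c_d≢0 , νc_d) integral below beyond = record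
    { start = c₀≢0 , (begin
        + d ℤ.* ν (c 0) ℤ.- + (s ℕ.* 0)  ≡⟨ cong₂ (λ v n → + d ℤ.* v ℤ.- + n) νc₀ (ℕP.*-zeroʳ s) ⟩
        + d ℤ.* ℤ.- + e ℤ.- 0ℤ          ≡⟨ start-eq (+ d) (+ e) ⟩
        ℤ.- (+ d ℤ.* + e)               ≡⟨ cong ℤ.-_ (sym (ℤP.pos-* d e)) ⟩
        ℤ.- + (d ℕ.* e)                 ∎)
    ; end = c_d≢0 , (begin
        + d ℤ.* ν (c d) ℤ.- + (s ℕ.* d)  ≡⟨ cong₂ (λ v n → + d ℤ.* v ℤ.- n) νc_d (ℤP.pos-* s d) ⟩
        + d ℤ.* (+ s ℤ.- + e) ℤ.- + s ℤ.* + d ≡⟨ end-eq (+ d) (+ s) (+ e) ⟩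
        ℤ.- (+ d ℤ.* + e)               ≡⟨ cong ℤ.-_ (sym (ℤP.pos-* d e)) ⟩
        ℤ.- + (d ℕ.* e)                 ∎)
    ; interior = λ k 0<k k<d ck≢0 → ℤP.<-≤-trans (ℤP.neg-mono-< (ℤ.+<+ (below k k<d)))
        (subst (ℤ._≤ W k (c k)) (ℤP.+-identityˡ _)
          (ℤP.+-monoˡ-≤ (ℤ.- + (s ℕ.* k))
            (subst (ℤ._≤ + d ℤ.* ν (c k)) (ℤP.*-zeroʳ (+ d)) (ℤP.*-monoˡ-≤-nonNeg (+ d) (integral k 0<k k<d ck≢0)))))
    ; beyond = beyond
    }
    where
    open ≡-Reasoning
    start-eq : ∀ D E → D ℤ.* ℤ.- E ℤ.- 0ℤ ≡ ℤ.- (D ℤ.* E)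
    start-eq = solve-∀
    end-eq : ∀ D S E → D ℤ.* (S ℤ.- E) ℤ.- S ℤ.* D ≡ ℤ.- (D ℤ.* E)
    end-eq = solve-∀

coeff-K : ∀ a n k → coeff (K a n) k ≡ coeff (X ^ₚ n) k + coeff (1−X ^ₚ n) k + coeff (const (a ^ℚ n)) k
coeff-K a n k = trans (coeff-+ (X ^ₚ n +ₚ 1−X ^ₚ n) (const (a ^ℚ n)) k)
                      (cong (_+ coeff (const (a ^ℚ n)) k) (coeff-+ (X ^ₚ n) (1−X ^ₚ n) k))

coeff-K-interior : ∀ a n {k} → 0 ℕ.< k → k ℕ.< n → coeff (K a n) k ≡ coeff (1−X ^ₚ n) k
coeff-K-interior a n {k@(suc _)} _ k<n = trans (coeff-K a n k)
  (trans (cong (λ z → z + coeff (1−X ^ₚ n) k + 0ℚ) (coeff-X^-off n (ℕP.<⇒≢ k<n)))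
         (trans (ℚP.+-identityʳ _) (ℚP.+-identityˡ _)))

coeff-K-top : ∀ a n → 1 ℕ.≤ n → coeff (K a n) n ≡ 1ℚ + (- 1ℚ) ^ℚ n
coeff-K-top a n@(suc _) _ = trans (coeff-K a n n)
  (trans (cong₂ (λ u v → u + v + 0ℚ) (coeff-X^-diag n) (coeff-1−X^-top n)) (ℚP.+-identityʳ _))

coeff-K-beyond : ∀ a n {k} → n ℕ.< k → coeff (K a n) k ≡ 0ℚ
coeff-K-beyond a n {k@(suc _)} n<k = trans (coeff-K a n k)
  (cong₂ (λ u v → u + v + 0ℚ) (coeff-X^-off n (ℕP.<⇒≢ n<k ∘ sym)) (coeff-1−X^-beyond n n<k))

coeff-K-constant : ∀ {a} n → ℤ.- 1ℤ ≡[ ν ] a → 1 ℕ.≤ n → ℤ.- + n ≡[ ν ] coeff (K a n) 0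
coeff-K-constant {a} n@(suc _) νa _ = subst (ℤ.- + n ≡[ ν ]_) (sym shape)
  (≡[]-+ʳ ν-ultrametric {ℤ.- + n} {1ℚ} {a ^ℚ n} (λ _ → subst (ℤ.- + n ℤ.<_) (sym ν-1) ℤ.-<+)
    (subst (_≡[ ν ] a ^ℚ n) (times-1 (+ n)) (^ℚ-≡[ν] n νa)))
  where
  shape : coeff (K a n) 0 ≡ 1ℚ + a ^ℚ n
  shape = trans (coeff-K a n 0)
    (cong₂ (λ u v → u + v + a ^ℚ n) (coeff-X^-off n (λ ())) (coeff-1−X^-zero n))
  times-1 : ∀ N → N ℤ.* ℤ.- 1ℤ ≡ ℤ.- N
  times-1 = solve-∀

module _ {a} (νa : ℤ.- 1ℤ ≡[ ν ] a) where

  K-even-irreducible : ∀ t → 1 ℕ.≤ t → Irreducible (K a (t ℕ.+ t))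
  K-even-irreducible t 1≤t = Newton.dumas n (suc n) 1≤n (coprime-suc n) {K a n} segment
    where
    n = t ℕ.+ t
    1≤n : 1 ℕ.≤ n
    1≤n = ℕP.≤-trans 1≤t (ℕP.m≤m+n t t)
    top : 1ℤ ≡[ ν ] coeff (K a n) n
    top = subst (1ℤ ≡[ ν ]_) (sym (trans (coeff-K-top a n 1≤n) (cong (_+_ 1ℚ) (-1^[t+t]≡1 t)))) ((λ ()) , ν-2)
    slope : ∀ k → k ℕ.< n → suc n ℕ.* k ℕ.< n ℕ.* n
    slope k k<n = ℕP.<-≤-trans (ℕP.+-monoˡ-< (n ℕ.* k) k<n)
                               (subst (ℕ._≤ n ℕ.* n) (ℕP.*-suc n k) (ℕP.*-monoʳ-≤ n k<n))
    segment = integralSegment n (suc n) (coeff-K-constant n νa 1≤n)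
      (subst (_≡[ ν ] coeff (K a n) n) (sym (one (+ n))) top)
      (λ k 0<k k<n → subst (0ℤ ≤[ ν ]_) (sym (coeff-K-interior a n 0<k k<n)) (coeff-1−X^-integral n k))
      slope (λ k → coeff-K-beyond a n)
      where
      one : ∀ N → (1ℤ ℤ.+ N) ℤ.- N ≡ 1ℤ
      one = solve-∀

  K-odd-irreducible : ∀ t → 1 ℕ.≤ t → Irreducible (K a (suc (t ℕ.+ t)))
  K-odd-irreducible t 1≤t = Newton.dumas m n 1≤m (coprime-suc m) {K a n} segment
    where
    m = t ℕ.+ t
    n = suc m
    1≤m : 1 ℕ.≤ m
    1≤m = ℕP.≤-trans 1≤t (ℕP.m≤m+n t t)
    subtop : coeff (K a n) m ≡ fromℕ n
    subtop = trans (coeff-K-interior a n 1≤m (ℕP.n<1+n m))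
                   (trans (coeff-1−X^-subtop m) (trans (cong (_* fromℕ n) (-1^[t+t]≡1 t)) (ℚP.*-identityˡ _)))
    top : coeff (K a n) n ≡ 0ℚ
    top = trans (coeff-K-top a n (s≤s z≤n)) (cong (λ u → 1ℚ + - 1ℚ * u) (-1^[t+t]≡1 t))
    beyond : ∀ k → m ℕ.< k → coeff (K a n) k ≡ 0ℚ
    beyond k m<k with ℕP.m≤n⇒m<n∨m≡n m<k
    ... | inj₁ n<k  = coeff-K-beyond a n n<k
    ... | inj₂ refl = top
    segment = integralSegment m n (coeff-K-constant n νa (s≤s z≤n))
      (subst₂ _≡[ ν ]_ (sym (ℤP.+-inverseʳ (+ n))) (sym subtop) (fromℕ-odd t))
      (λ k 0<k k<m → subst (0ℤ ≤[ ν ]_) (sym (coeff-K-interior a n 0<k (ℕP.m<n⇒m<1+n k<m))) (coeff-1−X^-integral n k))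
      (λ k k<m → subst (n ℕ.* k ℕ.<_) (ℕP.*-comm n m) (ℕP.*-monoʳ-< n k<m))
      beyond

ν-±½ : ∀ {a} → a ≡ ½ ⊎ a ≡ -½ → ℤ.- 1ℤ ≡[ ν ] a
ν-±½ (inj₁ refl) = (λ ()) , ν-½
ν-±½ (inj₂ refl) = (λ ()) , ν-[-½]

mainTheorem10 : (a : ℚ) → (a ≡ ½ ⊎ a ≡ -½) → (n : ℕ) → n ≥ 2 → Irreducible (K a n)
mainTheorem10 a a≡±½ n n≥2 with parity n
... | zero , inj₁ refl = ⊥-elim (ℕP.<⇒≱ n≥2 z≤n)
... | zero , inj₂ refl = ⊥-elim (ℕP.<⇒≱ n≥2 (s≤s z≤n))
... | t@(suc _) , inj₁ refl = K-even-irreducible (ν-±½ a≡±½) t (s≤s z≤n)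
... | t@(suc _) , inj₂ refl = K-odd-irreducible (ν-±½ a≡±½) t (s≤s z≤n)
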